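{- Let $H$ be a complete Heyting algebra, $A$ a Heyting algebra and $c\colon H\to A$ a Heyting algebra homomorphism. Let $x\in A$ and let $G\subseteq A$ be a subset such that $1_A=\bigvee_{y\in G}y$ (the join possibly infinite). Suppose that for every $y\in G$ there exists $h_y\in H$ with $y\wedge x=y\wedge c(h_y)$. Then $\bigvee_{h\in H}\big(x\Leftrightarrow c(h)\big)=1_A$.
   Context: In a Heyting algebra, $a\Leftrightarrow b$ denotes $(a\Rightarrow b)\wedge(b\Rightarrow a)$. -}

module Defs where

open import Level using (Level; _⊔_)
open import Data.Product using (Σ; Σ-syntax; _×_; proj₁)
open import Relation.Unary using (Pred)
open import Relation.Binary.Lattice.Bundles using (HeytingAlgebra)

module _ {c ℓ₁ ℓ₂ : Level} (A : HeytingAlgebra c ℓ₁ ℓ₂) where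
  open HeytingAlgebra A

  _⇔_ : Carrier → Carrier → Carrier
  a ⇔ b = (a ⇨ b) ∧ (b ⇨ a)

  IsUpperBound : {ι : Level} {I : Set ι} → (I → Carrier) → Carrier → Set (ι ⊔ ℓ₂)
  IsUpperBound f u = ∀ i → f i ≤ u

  IsJoin : {ι : Level} {I : Set ι} → (I → Carrier) → Carrier → Set (c ⊔ ι ⊔ ℓ₂)
  IsJoin f s = IsUpperBound f s × (∀ u → IsUpperBound f u → s ≤ u)

  IsJoinOfSubset : {ι : Level} → Pred Carrier ι → Carrier → Set (c ⊔ ι ⊔ ℓ₂)
  IsJoinOfSubset S s = IsJoin {I = Σ Carrier S} proj₁ s

  IsComplete : (ι : Level) → Set (c ⊔ Level.suc ι ⊔ ℓ₂)
  IsComplete ι = (S : Pred Carrier ι) → Σ[ s ∈ Carrier ] IsJoinOfSubset S s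

record IsHeytingHom {c ℓ₁ ℓ₂ c' ℓ₁' ℓ₂' : Level}
  (H : HeytingAlgebra c ℓ₁ ℓ₂) (A : HeytingAlgebra c' ℓ₁' ℓ₂')
  (f : HeytingAlgebra.Carrier H → HeytingAlgebra.Carrier A)
  : Set (c ⊔ ℓ₁ ⊔ ℓ₁') where
  module H = HeytingAlgebra H
  module A = HeytingAlgebra A
  field
    cong   : ∀ {a b} → a H.≈ b → f a A.≈ f b
    pres-∧ : ∀ a b → f (a H.∧ b) A.≈ (f a A.∧ f b)
    pres-∨ : ∀ a b → f (a H.∨ b) A.≈ (f a A.∨ f b)
    pres-⇨ : ∀ a b → f (a H.⇨ b) A.≈ (f a A.⇨ f b)
    pres-⊤ : f H.⊤ A.≈ A.⊤
    pres-⊥ : f H.⊥ A.≈ A.⊥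

{-# OPTIONS --safe #-}
-- Where x and c(h) agree on y, i.e. y ∧ x = y ∧ c(h), we get y ≤ x ⇔ c(h).
-- So every element of G lies below a member of the family (x ⇔ c(h))ₕ, and any
-- upper bound of that family bounds ⋁ G = ⊤.
module Submission where

open import Defs
open import Level using (Level)
open import Data.Product using (Σ; Σ-syntax; _,_)
open import Relation.Unary using (Pred)
open import Relation.Binary.Lattice.Bundles using (HeytingAlgebra)

module _ {c ℓ₁ ℓ₂ : Level} (A : HeytingAlgebra c ℓ₁ ℓ₂) where
  open HeytingAlgebra A

  y∧a≈y∧b⇒y≤a⇨b : ∀ {y a b} → y ∧ a ≈ y ∧ b → y ≤ a ⇨ b
  y∧a≈y∧b⇒y≤a⇨b {y} {a} {b} y∧a≈y∧b =
    transpose-⇨ (trans (reflexive y∧a≈y∧b) (x∧y≤y y b))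

  y∧a≈y∧b⇒y≤a⇔b : ∀ {y a b} → y ∧ a ≈ y ∧ b → y ≤ _⇔_ A a b
  y∧a≈y∧b⇒y≤a⇔b y∧a≈y∧b =
    ∧-greatest (y∧a≈y∧b⇒y≤a⇨b y∧a≈y∧b) (y∧a≈y∧b⇒y≤a⇨b (Eq.sym y∧a≈y∧b))

  isJoin-of-dominating : {ι κ : Level} {I : Set ι} {g : I → Carrier}
    {G : Pred Carrier κ} {s : Carrier} →
    IsJoinOfSubset A G s → IsUpperBound A g s →
    (∀ y → G y → Σ[ i ∈ I ] y ≤ g i) → IsJoin A g s
  isJoin-of-dominating (_ , s-least) g≤s dominating =
    g≤s , λ u g≤u → s-least u λ { (y , Gy) → let i , y≤gi = dominating y Gy
                                               in trans y≤gi (g≤u i) }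

lemma10 : {c ℓ₁ ℓ₂ c' ℓ₁' ℓ₂' ι κ : Level}
    (H : HeytingAlgebra c ℓ₁ ℓ₂) → IsComplete H ι →
    (A : HeytingAlgebra c' ℓ₁' ℓ₂') →
    (f : HeytingAlgebra.Carrier H → HeytingAlgebra.Carrier A) → IsHeytingHom H A f →
    (x : HeytingAlgebra.Carrier A) (G : Pred (HeytingAlgebra.Carrier A) κ) →
    IsJoinOfSubset A G (HeytingAlgebra.⊤ A) →
    (∀ y → G y → Σ[ h ∈ HeytingAlgebra.Carrier H ]
    HeytingAlgebra._≈_ A (HeytingAlgebra._∧_ A y x) (HeytingAlgebra._∧_ A y (f h))) →
    IsJoin A (λ h → _⇔_ A x (f h)) (HeytingAlgebra.⊤ A)
lemma10 H _ A f _ x G ⋁G≈⊤ agree =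
  isJoin-of-dominating A ⋁G≈⊤ (λ _ → maximum _) dominating
  where
  open HeytingAlgebra A using (_≤_; maximum)

  dominating : ∀ y → G y → Σ[ h ∈ HeytingAlgebra.Carrier H ] y ≤ _⇔_ A x (f h)
  dominating y Gy = let h , y∧x≈y∧fh = agree y Gy
                    in h , y∧a≈y∧b⇒y≤a⇔b A y∧x≈y∧fh
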